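{- There are infinitely many ordered, $(e,v)$-inseparable, linear $3$-uniform hypergraphs $S$ such that the graph $F_S$ is $4$-connected.
   Context: For an ordered $3$-uniform hypergraph $S=(V,E,<)$, the graph $F_S$ has vertex set $V$ and $xz$ is an edge of $F_S$ iff there is $xyz\in E$ with $x<y<z$. A hypergraph is linear if two distinct edges share at most one vertex; it is connected if for every partition $V=X\cup Y$ with $X,Y\ne\emptyset$ some edge meets both parts. A linear $3$-uniform $S$ is $(e,v)$-inseparable if (a) $S$ is connected with at least two edges, (b) for every $z\subseteq V$ with $|z|<3$ and no two vertices of $z$ in a common edge, $S-z$ (delete the vertices of $z$ and all edges meeting them) is connected, and (c) for every edge $e$, the hypergraph obtained by deleting all vertices of $e$ is connected. -}

module Defs where

open import Data.Nat using (ℕ)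
open import Data.Fin using (Fin; _<_)
open import Data.Bool using (Bool; true; false)
open import Data.Product using (Σ; ∃; ∃-syntax; _×_; _,_)
open import Data.Sum using (_⊎_)
open import Relation.Nullary using (¬_)
open import Relation.Binary.PropositionalEquality using (_≡_; _≢_)

-- An ordered 3-uniform hypergraph on the vertex set Fin n, ordered by the
-- usual order of Fin n.  The edge {x,y,z} with x < y < z is present iff
-- edgeBit x y z ≡ true (values of edgeBit on non-increasing triples are ignored).
record OHG : Set where
  field
    n       : ℕ
    edgeBit : Fin n → Fin n → Fin n → Bool
open OHG public

Edge : (S : OHG) → Fin (n S) → Fin (n S) → Fin (n S) → Set
Edge S x y z = (x < y) × (y < z) × (edgeBit S x y z ≡ true)

_∈₃_ : ∀ {m} → Fin m → (Fin m × Fin m × Fin m) → Set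
v ∈₃ (x , y , z) = (v ≡ x) ⊎ (v ≡ y) ⊎ (v ≡ z)

EdgeT : OHG → Set
EdgeT S = Σ (Fin (n S) × Fin (n S) × Fin (n S)) λ { (x , y , z) → Edge S x y z }

vs : ∀ {S} → EdgeT S → Fin (n S) × Fin (n S) × Fin (n S)
vs (t , _) = t

Linear : OHG → Set
Linear S = (e f : EdgeT S) → (u v : Fin (n S)) → u ≢ v →
           u ∈₃ vs e → v ∈₃ vs e → u ∈₃ vs f → v ∈₃ vs f → vs e ≡ vs f

-- The sub-hypergraph induced on the vertex set W (i.e. S minus the vertices
-- outside W, together with all edges meeting them) is connected: for every
-- partition of W into two nonempty parts (given by a colouring P), some
-- surviving edge meets both parts.
ConnectedOn : (S : OHG) → (Fin (n S) → Set) → Set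
ConnectedOn S W =
  (P : Fin (n S) → Bool) →
  (∃[ a ] (W a × P a ≡ true)) → (∃[ b ] (W b × P b ≡ false)) →
  ∃[ e ] (((v : Fin (n S)) → v ∈₃ vs {S} e → W v) ×
          (∃[ a ] (a ∈₃ vs {S} e × P a ≡ true)) ×
          (∃[ b ] (b ∈₃ vs {S} e × P b ≡ false)))

Connected : OHG → Set
Connected S = ConnectedOn S (λ _ → Data.Unit.⊤) where import Data.Unit

EVInseparable : OHG → Set
EVInseparable S =
  (Connected S × ∃[ e ] ∃[ f ] (vs {S} e ≢ vs {S} f)) ×
  -- (b) for z = {u,v} with |z| < 3 (z = ∅ is covered by (a); u ≡ v gives
  --     |z| = 1) and no two vertices of z in a common edge, S - z is connected
  ((u v : Fin (n S)) →
     (u ≡ v ⊎ ¬ (∃[ e ] (u ∈₃ vs {S} e × v ∈₃ vs {S} e))) →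
     ConnectedOn S (λ w → (w ≢ u) × (w ≢ v))) ×
  ((e : EdgeT S) → ConnectedOn S (λ w → ¬ (w ∈₃ vs {S} e)))

FAdj : (S : OHG) → Fin (n S) → Fin (n S) → Set
FAdj S a b = (∃[ y ] Edge S a y b) ⊎ (∃[ y ] Edge S b y a)

GraphConnectedOn : ∀ {m} → (Fin m → Fin m → Set) → (Fin m → Set) → Set
GraphConnectedOn {m} A W =
  (P : Fin m → Bool) →
  (∃[ a ] (W a × P a ≡ true)) → (∃[ b ] (W b × P b ≡ false)) →
  ∃[ a ] ∃[ b ] (W a × W b × A a b × P a ≡ true × P b ≡ false)

-- k-connected for k = 4: more than 4 vertices, and deleting any set of at
-- most 3 vertices {a,b,c} (repetitions allowed) leaves a connected graph
FourConnected : ∀ {m} → (Fin m → Fin m → Set) → Set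
FourConnected {m} A =
  (4 Data.Nat.< m) ×
  ((a b c : Fin m) → GraphConnectedOn A (λ w → (w ≢ a) × (w ≢ b) × (w ≢ c)))

{-# OPTIONS --safe #-}
module Submission where

-- S has bottom hubs B j and top hubs T j (j < 4) and N + 4 blocks q of leaves L q p and R q p
-- (p ∈ ℤ/8), ordered B < block 0 < block 1 < ⋯ < T, with L q before R q inside a block.  The hub
-- T j carries the shift j and B j the shift 4 + j; the edges are {L q p, R q (p + s), h} for every
-- block q, leaf p and hub h of shift s, together with the cross edges {L 0 t, L 1 t, R 2 t}.
-- Inside a block each pair L, R lies in exactly one hub edge, so any two vertices of an edge
-- determine it and S is linear.
-- Deleting at most three vertices destroys at most three of four pairwise disjoint vertex sets.
-- In the hypergraph a surviving leaf lies in four top-hub edges whose other vertices are disjoint,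
-- so one of them joins it to a hub; two hubs are joined through their edges at L q 0, for a block
-- q in which those edges survive.  In F_S every L-leaf is adjacent to all top hubs, every R-leaf
-- to all bottom hubs, and a surviving cross pair L 0 t, R 2 t joins the two sides.

open import Defs
open import Data.Nat using (ℕ; _≤_)
open import Data.Product using (∃-syntax; _×_)
open import Data.Nat as ℕ using (_<_; _+_; _*_; _∸_)
import Data.Nat.Properties as ℕP
open import Data.Nat.DivMod using (m%n<n)
open import Data.Fin as F using (Fin; toℕ; fromℕ<; _↑ˡ_; _↑ʳ_; splitAt; combine; remQuot)
open import Data.Fin.Patterns using (0F; 1F; 2F)
import Data.Fin.Properties as FP
open import Data.Bool using (Bool; true; false; not)
open import Data.Bool.Properties using (not-injective; T-≡)
open import Data.Unit using (tt)
open import Data.Product using (∃₂; _,_; proj₁; proj₂; uncurry; map₂)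
open import Data.Product.Properties using (≡-dec; ,-injective)
open import Data.Sum using (_⊎_; inj₁; inj₂; [_,_]′; swap)
open import Data.List using (List; []; _∷_; length; lookup; map)
open import Data.List.Properties using (length-map)
open import Data.List.Relation.Unary.All as All using (All; []; _∷_)
open import Data.List.Relation.Unary.All.Properties using (¬Any⇒All¬)
open import Data.List.Relation.Unary.Any as Any using (here; there)
open import Data.List.Relation.Unary.Any.Properties using (lookup-index)
open import Data.List.Membership.Propositional using (_∈_; _∉_; find)
open import Data.List.Membership.Propositional.Properties using (∈-map⁺)
import Data.List.Membership.DecPropositional as DecMembership
open import Function using (id; _∘_)
open import Function.Bundles using (Equivalence)
open import Relation.Binary.Definitions using (DecidableEquality; Symmetric)
open import Relation.Binary.PropositionalEquality
open import Relation.Nullary using (¬_; Dec; yes; no; ¬?; contradiction)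
open import Relation.Nullary.Decidable using (from-yes; map′; isYes; toWitness; fromWitness)

module _ {A : Set} (_≟_ : DecidableEquality A) where
  open DecMembership _≟_ using (_∈?_)

  some-candidate-avoids : ∀ {n} (dels : List A) → length dels < n → (cand : Fin n → List A) →
                          (∀ {a i j} → a ∈ cand i → a ∈ cand j → i ≡ j) →
                          ∃[ j ] All (_∉ dels) (cand j)
  some-candidate-avoids {n} dels few cand disjoint
    with FP.any? (λ j → All.all? (λ a → ¬? (a ∈? dels)) (cand j))
  ... | yes found = found
  ... | no none = contradiction (FP.pigeonhole few killer) collision
    where
      hit : ∀ j → ∃[ a ] (a ∈ cand j × a ∈ dels)
      hit j with Any.any? (_∈? dels) (cand j)
      ... | yes h = find h
      ... | no h = contradiction (j , ¬Any⇒All¬ _ h) none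

      culprit : Fin n → A
      culprit j = proj₁ (hit j)

      culprit-candidate : ∀ j → culprit j ∈ cand j
      culprit-candidate j = proj₁ (proj₂ (hit j))

      killer : Fin n → Fin (length dels)
      killer j = Any.index (proj₂ (proj₂ (hit j)))

      culprit-killer : ∀ j → culprit j ≡ lookup dels (killer j)
      culprit-killer j = lookup-index (proj₂ (proj₂ (hit j)))

      collision : ¬ ∃₂ λ i j → i F.< j × killer i ≡ killer j
      collision (i , j , i<j , same) =
        FP.<⇒≢ i<j (disjoint (culprit-candidate i) (subst (_∈ cand j) (sym same-culprit) (culprit-candidate j)))
        where
          same-culprit : culprit i ≡ culprit j
          same-culprit = trans (culprit-killer i) (trans (cong (lookup dels) same) (sym (culprit-killer j)))

labelled-disjoint : ∀ {A X : Set} {n} {cand : Fin n → List A} (label : A → X) {tag : Fin n → X} →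
                    (∀ {i j} → tag i ≡ tag j → i ≡ j) →
                    (∀ i → All (λ a → label a ≡ tag i) (cand i)) →
                    ∀ {a i j} → a ∈ cand i → a ∈ cand j → i ≡ j
labelled-disjoint label tag-injective labelled {i = i} {j} a∈i a∈j =
  tag-injective (trans (sym (All.lookup (labelled i) a∈i)) (All.lookup (labelled j) a∈j))

module Linking {m : ℕ} (Crossing : (Fin m → Bool) → Set)
               (complement : ∀ {P} → Crossing (not ∘ P) → Crossing P) where

  Linked : Fin m → Fin m → Set
  Linked a b = ∀ P → P a ≡ true → P b ≡ false → Crossing P

  linked-refl : ∀ {a} → Linked a a
  linked-refl P Pa≡true Pa≡false = contradiction (trans (sym Pa≡true) Pa≡false) λ ()

  linked-sym : ∀ {a b} → Linked a b → Linked b a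
  linked-sym a~b P Pb≡true Pa≡false = complement (a~b (not ∘ P) (cong not Pa≡false) (cong not Pb≡true))

  linked-trans : ∀ {a b c} → Linked a b → Linked b c → Linked a c
  linked-trans {b = b} a~b b~c P Pa≡true Pc≡false with P b in Pb
  ... | true  = b~c P Pb Pc≡false
  ... | false = a~b P Pa≡true Pb

  connected : ∀ {W : Fin m → Set} → (∀ {a b} → W a → W b → Linked a b) →
              ∀ P → ∃[ a ] (W a × P a ≡ true) → ∃[ b ] (W b × P b ≡ false) → Crossing P
  connected all-linked P (a , Wa , Pa≡true) (b , Wb , Pb≡false) = all-linked Wa Wb P Pa≡true Pb≡false

HyperCrossing : (S : OHG) → (Fin (n S) → Set) → (Fin (n S) → Bool) → Set
HyperCrossing S W P =
  ∃[ e ] (((v : Fin (n S)) → v ∈₃ vs {S} e → W v) ×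
          (∃[ a ] (a ∈₃ vs {S} e × P a ≡ true)) ×
          (∃[ b ] (b ∈₃ vs {S} e × P b ≡ false)))

module HyperLinking (S : OHG) (W : Fin (n S) → Set) where

  complement : ∀ {P} → HyperCrossing S W (not ∘ P) → HyperCrossing S W P
  complement (e , inside , (a , a∈e , ¬Pa) , (b , b∈e , ¬¬Pb)) =
    e , inside , (b , b∈e , not-injective ¬¬Pb) , (a , a∈e , not-injective ¬Pa)

  open Linking (HyperCrossing S W) complement public

  linked-in-edge : ∀ (e : EdgeT S) → (∀ v → v ∈₃ vs {S} e → W v) →
                   ∀ {a b} → a ∈₃ vs {S} e → b ∈₃ vs {S} e → Linked a b
  linked-in-edge e inside a∈e b∈e P Pa≡true Pb≡false =
    e , inside , (_ , a∈e , Pa≡true) , (_ , b∈e , Pb≡false)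

  connectedOn : (∀ {a b} → W a → W b → Linked a b) → ConnectedOn S W
  connectedOn = connected

GraphCrossing : ∀ {m} → (Fin m → Fin m → Set) → (Fin m → Set) → (Fin m → Bool) → Set
GraphCrossing A W P = ∃[ a ] ∃[ b ] (W a × W b × A a b × P a ≡ true × P b ≡ false)

module GraphLinking {m} {A : Fin m → Fin m → Set} (A-sym : Symmetric A) (W : Fin m → Set) where

  complement : ∀ {P} → GraphCrossing A W (not ∘ P) → GraphCrossing A W P
  complement (a , b , Wa , Wb , ab , ¬Pa , ¬¬Pb) =
    b , a , Wb , Wa , A-sym ab , not-injective ¬¬Pb , not-injective ¬Pa

  open Linking (GraphCrossing A W) complement public

  linked-adjacent : ∀ {a b} → W a → W b → A a b → Linked a b
  linked-adjacent Wa Wb ab P Pa≡true Pb≡false = _ , _ , Wa , Wb , ab , Pa≡true , Pb≡false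

  graphConnectedOn : (∀ {a b} → W a → W b → Linked a b) → GraphConnectedOn A W
  graphConnectedOn = connected

FAdj-sym : ∀ S → Symmetric (FAdj S)
FAdj-sym S = swap

All-pairs : ∀ {A : Set} → (A → A → Set) → A × A × A → Set
All-pairs R (x , y , z) = R x y × R y x × R x z × R z x × R y z × R z y

all-pairs-∈₃ : ∀ {m} {R : Fin m → Fin m → Set} {t u v} →
               All-pairs R t → u ∈₃ t → v ∈₃ t → u ≢ v → R u v
all-pairs-∈₃ _ (inj₁ refl) (inj₁ refl) u≢v = contradiction refl u≢v
all-pairs-∈₃ _ (inj₂ (inj₁ refl)) (inj₂ (inj₁ refl)) u≢v = contradiction refl u≢v
all-pairs-∈₃ _ (inj₂ (inj₂ refl)) (inj₂ (inj₂ refl)) u≢v = contradiction refl u≢v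
all-pairs-∈₃ (xy , yx , xz , zx , yz , zy) (inj₁ refl) (inj₂ (inj₁ refl)) _ = xy
all-pairs-∈₃ (xy , yx , xz , zx , yz , zy) (inj₂ (inj₁ refl)) (inj₁ refl) _ = yx
all-pairs-∈₃ (xy , yx , xz , zx , yz , zy) (inj₁ refl) (inj₂ (inj₂ refl)) _ = xz
all-pairs-∈₃ (xy , yx , xz , zx , yz , zy) (inj₂ (inj₂ refl)) (inj₁ refl) _ = zx
all-pairs-∈₃ (xy , yx , xz , zx , yz , zy) (inj₂ (inj₁ refl)) (inj₂ (inj₂ refl)) _ = yz
all-pairs-∈₃ (xy , yx , xz , zx , yz , zy) (inj₂ (inj₂ refl)) (inj₂ (inj₁ refl)) _ = zy

∈₃⇒∈ : ∀ {m} {v x y z : Fin m} → v ∈₃ (x , y , z) → v ∈ x ∷ y ∷ z ∷ []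
∈₃⇒∈ = [ here , [ there ∘ here , there ∘ there ∘ here ]′ ]′

infixl 6 _⊕_ _⊖_

_⊕_ : Fin 8 → Fin 8 → Fin 8
p ⊕ s = fromℕ< (m%n<n (toℕ p + toℕ s) 8)

_⊖_ : Fin 8 → Fin 8 → Fin 8
p ⊖ s = fromℕ< (m%n<n (8 + toℕ p ∸ toℕ s) 8)

⊕-⊖-cancelˡ : ∀ p s → p ⊕ s ⊖ p ≡ s
⊕-⊖-cancelˡ = from-yes (FP.all? λ p → FP.all? λ s → p ⊕ s ⊖ p FP.≟ s)

⊕-⊖-cancelʳ : ∀ p s → p ⊕ s ⊖ s ≡ p
⊕-⊖-cancelʳ = from-yes (FP.all? λ p → FP.all? λ s → p ⊕ s ⊖ s FP.≟ p)

⊖-⊕-cancel : ∀ p s → p ⊖ s ⊕ s ≡ p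
⊖-⊕-cancel = from-yes (FP.all? λ p → FP.all? λ s → p ⊖ s ⊕ s FP.≟ p)

⊖-⊖-cancelˡ : ∀ p s → p ⊖ (p ⊖ s) ≡ s
⊖-⊖-cancelˡ = from-yes (FP.all? λ p → FP.all? λ s → p ⊖ (p ⊖ s) FP.≟ s)

combine-monoʳ-< : ∀ {m n} (i : Fin m) {j k : Fin n} → j F.< k → combine i j F.< combine i k
combine-monoʳ-< {n = n} i {j} {k} j<k =
  subst₂ ℕ._<_ (sym (FP.toℕ-combine i j)) (sym (FP.toℕ-combine i k)) (ℕP.+-monoʳ-< (n * toℕ i) j<k)

↑ˡ<↑ʳ : ∀ {m n} (i : Fin m) (j : Fin n) → i ↑ˡ n F.< m ↑ʳ j
↑ˡ<↑ʳ {m} {n} i j = begin-strict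
  toℕ (i ↑ˡ n) ≡⟨ FP.toℕ-↑ˡ i n ⟩
  toℕ i        <⟨ FP.toℕ<n i ⟩
  m            ≤⟨ ℕP.m≤m+n m (toℕ j) ⟩
  m + toℕ j    ≡⟨ FP.toℕ-↑ʳ m j ⟨
  toℕ (m ↑ʳ j) ∎
  where open ℕP.≤-Reasoning

module Construction (N : ℕ) where

  Q : ℕ
  Q = 4 + N

  data Hub : Set where
    bot top : Fin 4 → Hub

  data Node : Set where
    B T : Fin 4 → Node
    L R : Fin Q → Fin 8 → Node

  hub : Hub → Node
  hub (bot j) = B j
  hub (top j) = T j

  shift : Hub → Fin 8
  shift (top j) = j ↑ˡ 4
  shift (bot j) = 4 ↑ʳ j

  size : ℕ
  size = 4 + (Q * 16 + 4)

  V : Set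
  V = Fin size

  leaf : Fin Q → Fin 16 → V
  leaf q r = 4 ↑ʳ (combine q r ↑ˡ 4)

  vertex : Node → V
  vertex (B j)   = j ↑ˡ (Q * 16 + 4)
  vertex (L q p) = leaf q (p ↑ˡ 8)
  vertex (R q p) = leaf q (8 ↑ʳ p)
  vertex (T j)   = 4 ↑ʳ (Q * 16 ↑ʳ j)

  leafNode : Fin Q → Fin 8 ⊎ Fin 8 → Node
  leafNode q (inj₁ p) = L q p
  leafNode q (inj₂ p) = R q p

  blockNode : Fin Q × Fin 16 → Node
  blockNode (q , r) = leafNode q (splitAt 8 r)

  innerNode : Fin (Q * 16) ⊎ Fin 4 → Node
  innerNode (inj₁ i) = blockNode (remQuot {Q} 16 i)
  innerNode (inj₂ j) = T j

  outerNode : Fin 4 ⊎ Fin (Q * 16 + 4) → Node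
  outerNode (inj₁ j) = B j
  outerNode (inj₂ i) = innerNode (splitAt (Q * 16) i)

  node : V → Node
  node v = outerNode (splitAt 4 v)

  node-leaf : ∀ q r → node (leaf q r) ≡ blockNode (q , r)
  node-leaf q r = trans (cong innerNode (FP.splitAt-↑ˡ (Q * 16) (combine q r) 4))
                        (cong blockNode (FP.remQuot-combine q r))

  node-vertex : ∀ k → node (vertex k) ≡ k
  node-vertex (B j)   = cong outerNode (FP.splitAt-↑ˡ 4 j (Q * 16 + 4))
  node-vertex (L q p) = trans (node-leaf q (p ↑ˡ 8)) (cong (leafNode q) (FP.splitAt-↑ˡ 8 p 8))
  node-vertex (R q p) = trans (node-leaf q (8 ↑ʳ p)) (cong (leafNode q) (FP.splitAt-↑ʳ 8 8 p))
  node-vertex (T j)   = cong innerNode (FP.splitAt-↑ʳ (Q * 16) 4 j)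

  vertex-blockNode : ∀ qr → vertex (blockNode qr) ≡ uncurry leaf qr
  vertex-blockNode (q , r) with splitAt 8 r in eq
  ... | inj₁ p = cong (leaf q) (FP.splitAt⁻¹-↑ˡ eq)
  ... | inj₂ p = cong (leaf q) (FP.splitAt⁻¹-↑ʳ eq)

  vertex-node : ∀ v → vertex (node v) ≡ v
  vertex-node v with splitAt 4 v in eq
  ... | inj₁ j = FP.splitAt⁻¹-↑ˡ eq
  ... | inj₂ i with splitAt (Q * 16) i in eq′
  ...   | inj₂ j = trans (cong (4 ↑ʳ_) (FP.splitAt⁻¹-↑ʳ eq′)) (FP.splitAt⁻¹-↑ʳ eq)
  ...   | inj₁ c = begin
    vertex (blockNode (remQuot {Q} 16 c))          ≡⟨ vertex-blockNode (remQuot {Q} 16 c) ⟩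
    4 ↑ʳ (uncurry combine (remQuot {Q} 16 c) ↑ˡ 4) ≡⟨ cong (λ c → 4 ↑ʳ (c ↑ˡ 4)) (FP.combine-remQuot {Q} 16 c) ⟩
    4 ↑ʳ (c ↑ˡ 4)                                  ≡⟨ cong (4 ↑ʳ_) (FP.splitAt⁻¹-↑ˡ eq′) ⟩
    4 ↑ʳ i                                         ≡⟨ FP.splitAt⁻¹-↑ʳ eq ⟩
    v                                              ∎
    where open ≡-Reasoning

  vertex-injective : ∀ {k k′} → vertex k ≡ vertex k′ → k ≡ k′
  vertex-injective {k} {k′} eq = trans (sym (node-vertex k)) (trans (cong node eq) (node-vertex k′))

  node-injective : ∀ {u v} → node u ≡ node v → u ≡ v
  node-injective {u} {v} eq = trans (sym (vertex-node u)) (trans (cong vertex eq) (vertex-node v))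

  _≟_ : DecidableEquality Node
  k ≟ k′ = map′ vertex-injective (cong vertex) (vertex k FP.≟ vertex k′)

  toℕ-leaf : ∀ q r → toℕ (leaf q r) ≡ 4 + toℕ (combine q r)
  toℕ-leaf q r = cong (4 +_) (FP.toℕ-↑ˡ (combine q r) 4)

  B<leaf : ∀ j q r → vertex (B j) F.< leaf q r
  B<leaf j q r = begin-strict
    toℕ (j ↑ˡ (Q * 16 + 4)) ≡⟨ FP.toℕ-↑ˡ j _ ⟩
    toℕ j                   <⟨ FP.toℕ<n j ⟩
    4                       ≤⟨ ℕP.m≤m+n 4 _ ⟩
    4 + toℕ (combine q r)   ≡⟨ toℕ-leaf q r ⟨
    toℕ (leaf q r)          ∎
    where open ℕP.≤-Reasoning

  leaf<T : ∀ q r j → leaf q r F.< vertex (T j)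
  leaf<T q r j = begin-strict
    toℕ (leaf q r)             ≡⟨ toℕ-leaf q r ⟩
    4 + toℕ (combine q r)      <⟨ ℕP.+-monoʳ-< 4 (FP.toℕ<n (combine q r)) ⟩
    4 + Q * 16                 ≤⟨ ℕP.+-monoʳ-≤ 4 (ℕP.m≤m+n (Q * 16) (toℕ j)) ⟩
    4 + (Q * 16 + toℕ j)       ≡⟨ cong (4 +_) (FP.toℕ-↑ʳ (Q * 16) j) ⟨
    toℕ (vertex (T j))         ∎
    where open ℕP.≤-Reasoning

  leaf-mono : ∀ q r q′ r′ → combine q r F.< combine q′ r′ → leaf q r F.< leaf q′ r′
  leaf-mono q r q′ r′ lt =
    subst₂ ℕ._<_ (sym (toℕ-leaf q r)) (sym (toℕ-leaf q′ r′)) (ℕP.+-monoʳ-< 4 lt)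

  block-mono : ∀ q q′ r r′ → q F.< q′ → leaf q r F.< leaf q′ r′
  block-mono q q′ r r′ q<q′ = leaf-mono q r q′ r′ (FP.combine-monoˡ-< {i = q} {q′} r r′ q<q′)

  L<R : ∀ q p p′ → vertex (L q p) F.< vertex (R q p′)
  L<R q p p′ = leaf-mono q _ q _ (combine-monoʳ-< q (↑ˡ<↑ʳ {8} {8} p p′))

  data IsEdge : Node → Node → Node → Set where
    topEdge   : ∀ q p j → IsEdge (L q p) (R q (p ⊕ shift (top j))) (T j)
    botEdge   : ∀ q p j → IsEdge (B j) (L q p) (R q (p ⊕ shift (bot j)))
    crossEdge : ∀ t → IsEdge (L 0F t) (L 1F t) (R 2F t)

  ordered : ∀ {a b c} → IsEdge a b c → vertex a F.< vertex b × vertex b F.< vertex c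
  ordered (topEdge q p j) = L<R q p _ , leaf<T q _ j
  ordered (botEdge q p j) = B<leaf j q _ , L<R q p _
  ordered (crossEdge t)   = block-mono 0F 1F _ _ ℕ.z<s , block-mono 1F 2F _ _ (ℕ.s<s ℕ.z<s)

  isEdge? : ∀ a b c → Dec (IsEdge a b c)
  isEdge? (B j) (L q p) c =
    map′ (λ { refl → botEdge q p j }) (λ { (botEdge _ _ _) → refl }) (c ≟ R q (p ⊕ shift (bot j)))
  isEdge? (L q p) (R q′ p′) (T j) =
    map′ (λ { refl → topEdge q p j }) (λ { (topEdge _ _ _) → refl }) (R q′ p′ ≟ R q (p ⊕ shift (top j)))
  isEdge? (L q p) (L q′ p′) c =
    map′ (λ { refl → crossEdge p }) (λ { (crossEdge _) → refl })
         (≡-dec _≟_ (≡-dec _≟_ _≟_) (L q p , L q′ p′ , c) (L 0F p , L 1F p , R 2F p))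
  isEdge? (B _)   (B _)   _       = no λ ()
  isEdge? (B _)   (R _ _) _       = no λ ()
  isEdge? (B _)   (T _)   _       = no λ ()
  isEdge? (L _ _) (B _)   _       = no λ ()
  isEdge? (L _ _) (T _)   _       = no λ ()
  isEdge? (L _ _) (R _ _) (B _)   = no λ ()
  isEdge? (L _ _) (R _ _) (L _ _) = no λ ()
  isEdge? (L _ _) (R _ _) (R _ _) = no λ ()
  isEdge? (R _ _) _       _       = no λ ()
  isEdge? (T _)   _       _       = no λ ()

  S : OHG
  S = record { n = size ; edgeBit = λ x y z → isYes (isEdge? (node x) (node y) (node z)) }

  edge : ∀ {a b c} → IsEdge a b c → Edge S (vertex a) (vertex b) (vertex c)
  edge {a} {b} {c} e = proj₁ (ordered e) , proj₂ (ordered e) , present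
    where
      present : isYes (isEdge? (node (vertex a)) (node (vertex b)) (node (vertex c))) ≡ true
      present rewrite node-vertex a | node-vertex b | node-vertex c =
        Equivalence.to T-≡ (fromWitness {a? = isEdge? a b c} e)

  edgeT : ∀ {a b c} → IsEdge a b c → EdgeT S
  edgeT {a} {b} {c} e = (vertex a , vertex b , vertex c) , edge e

  isEdge-node : ∀ {x y z} → Edge S x y z → IsEdge (node x) (node y) (node z)
  isEdge-node {x} {y} {z} (_ , _ , present) =
    toWitness {a? = isEdge? (node x) (node y) (node z)} (Equivalence.from T-≡ present)

  Triple : Set
  Triple = Node × Node × Node

  hubOf : Fin 8 → Hub
  hubOf s = [ top , bot ]′ (splitAt 4 s)

  hubOf-shift : ∀ c → hubOf (shift c) ≡ c
  hubOf-shift (top j) = cong [ top , bot ]′ (FP.splitAt-↑ˡ 4 j 4)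
  hubOf-shift (bot j) = cong [ top , bot ]′ (FP.splitAt-↑ʳ 4 4 j)

  hubTriple : Hub → Fin Q → Fin 8 → Triple
  hubTriple (top j) q p = L q p , R q (p ⊕ shift (top j)) , T j
  hubTriple (bot j) q p = B j , L q p , R q (p ⊕ shift (bot j))

  crossTriple : Fin 8 → Triple
  crossTriple t = L 0F t , L 1F t , R 2F t

  leafPairTriple : Fin Q → Fin 8 → Fin Q → Fin 8 → Triple
  leafPairTriple q p q′ p′ with q FP.≟ q′
  ... | yes _ = hubTriple (hubOf (p′ ⊖ p)) q p
  ... | no  _ = crossTriple p

  edgeThrough : Node → Node → Triple
  edgeThrough (L q p)   (R q′ p′) = leafPairTriple q p q′ p′
  edgeThrough (R q′ p′) (L q p)   = leafPairTriple q p q′ p′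
  edgeThrough (L _ p)   (L _ _)   = crossTriple p
  edgeThrough (L q p)   (T j)     = hubTriple (top j) q p
  edgeThrough (T j)     (L q p)   = hubTriple (top j) q p
  edgeThrough (L q p)   (B j)     = hubTriple (bot j) q p
  edgeThrough (B j)     (L q p)   = hubTriple (bot j) q p
  edgeThrough (R q p′)  (T j)     = hubTriple (top j) q (p′ ⊖ shift (top j))
  edgeThrough (T j)     (R q p′)  = hubTriple (top j) q (p′ ⊖ shift (top j))
  edgeThrough (R q p′)  (B j)     = hubTriple (bot j) q (p′ ⊖ shift (bot j))
  edgeThrough (B j)     (R q p′)  = hubTriple (bot j) q (p′ ⊖ shift (bot j))
  edgeThrough _         _         = crossTriple 0F  -- no edge contains such a pair

  edgeThrough-L-R : ∀ c q p → edgeThrough (L q p) (R q (p ⊕ shift c)) ≡ hubTriple c q p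
  edgeThrough-L-R c q p with q FP.≟ q
  ... | no q≢q = contradiction refl q≢q
  ... | yes _  = begin
    hubTriple (hubOf (p ⊕ shift c ⊖ p)) q p ≡⟨ cong (λ s → hubTriple (hubOf s) q p) (⊕-⊖-cancelˡ p _) ⟩
    hubTriple (hubOf (shift c)) q p         ≡⟨ cong (λ c → hubTriple c q p) (hubOf-shift c) ⟩
    hubTriple c q p                         ∎
    where open ≡-Reasoning

  edgeThrough-R-hub : ∀ c q p → edgeThrough (R q (p ⊕ shift c)) (hub c) ≡ hubTriple c q p
  edgeThrough-R-hub (top j) q p = cong (hubTriple (top j) q) (⊕-⊖-cancelʳ p (shift (top j)))
  edgeThrough-R-hub (bot j) q p = cong (hubTriple (bot j) q) (⊕-⊖-cancelʳ p (shift (bot j)))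

  edgeThrough-edge : ∀ {a b c} → IsEdge a b c → All-pairs (λ u v → edgeThrough u v ≡ (a , b , c)) (a , b , c)
  edgeThrough-edge (topEdge q p j) = edgeThrough-L-R (top j) q p , edgeThrough-L-R (top j) q p , refl , refl ,
                                     edgeThrough-R-hub (top j) q p , edgeThrough-R-hub (top j) q p
  edgeThrough-edge (botEdge q p j) = refl , refl , edgeThrough-R-hub (bot j) q p , edgeThrough-R-hub (bot j) q p ,
                                     edgeThrough-L-R (bot j) q p , edgeThrough-L-R (bot j) q p
  edgeThrough-edge (crossEdge t)   = refl , refl , refl , refl , refl , refl

  nodes-injective : ∀ {x y z x′ y′ z′} → (node x , node y , node z) ≡ (node x′ , node y′ , node z′) →
                    (x , y , z) ≡ (x′ , y′ , z′)
  nodes-injective eq = let x≡ , yz≡ = ,-injective eq ; y≡ , z≡ = ,-injective yz≡ in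
    cong₂ _,_ (node-injective x≡) (cong₂ _,_ (node-injective y≡) (node-injective z≡))

  linear : Linear S
  linear ((x , y , z) , e) ((x′ , y′ , z′) , e′) u v u≢v u∈e v∈e u∈e′ v∈e′ =
    nodes-injective (trans (sym (through e u∈e v∈e)) (through e′ u∈e′ v∈e′))
    where
      through : ∀ {x y z} → Edge S x y z → u ∈₃ (x , y , z) → v ∈₃ (x , y , z) →
                edgeThrough (node u) (node v) ≡ (node x , node y , node z)
      through e u∈ v∈ = all-pairs-∈₃ {R = λ u v → edgeThrough (node u) (node v) ≡ _}
                                     (edgeThrough-edge (isEdge-node e)) u∈ v∈ u≢v

  N≤size : N ≤ size
  N≤size = begin
    N           ≤⟨ ℕP.m≤n+m N 4 ⟩
    Q           ≤⟨ ℕP.m≤m*n Q 16 ⟩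
    Q * 16      ≤⟨ ℕP.m≤m+n (Q * 16) 4 ⟩
    Q * 16 + 4  ≤⟨ ℕP.m≤n+m (Q * 16 + 4) 4 ⟩
    size        ∎
    where open ℕP.≤-Reasoning

  4<size : 4 < size
  4<size = ℕP.m<m+n 4 ℕ.z<s

  two-edges : ∃[ e ] ∃[ f ] (vs {S} e ≢ vs {S} f)
  two-edges = edgeT (topEdge 0F 0F 0F) , edgeT (topEdge 0F 0F 1F) ,
              (λ ()) ∘ vertex-injective {T 0F} {T 1F} ∘ cong (proj₂ ∘ proj₂)

  adjacent-L-T : ∀ q p j → FAdj S (vertex (L q p)) (vertex (T j))
  adjacent-L-T q p j = inj₁ (_ , edge (topEdge q p j))

  adjacent-B-R : ∀ j q p′ → FAdj S (vertex (B j)) (vertex (R q p′))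
  adjacent-B-R j q p′ =
    subst (λ p′ → FAdj S (vertex (B j)) (vertex (R q p′))) (⊖-⊕-cancel p′ (shift (bot j)))
          (inj₁ (_ , edge (botEdge q (p′ ⊖ shift (bot j)) j)))

  adjacent-L-R : ∀ t → FAdj S (vertex (L 0F t)) (vertex (R 2F t))
  adjacent-L-R t = inj₁ (_ , edge (crossEdge t))

  module Deleting (deleted : List V) (few : length deleted ≤ 3) {W : V → Set}
                  (survives : ∀ v → v ∉ deleted → W v) where

    Alive : Node → Set
    Alive k = W (vertex k)

    alive : ∀ {k} → k ∉ map node deleted → Alive k
    alive {k} k∉ =
      survives (vertex k) λ k∈ → k∉ (subst (_∈ map node deleted) (node-vertex k) (∈-map⁺ node k∈))

    on-nodes : ∀ {Linked : V → V → Set} →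
               (∀ k k′ → Alive k → Alive k′ → Linked (vertex k) (vertex k′)) →
               ∀ {a b} → W a → W b → Linked a b
    on-nodes {Linked} linked {a} {b} Wa Wb =
      subst₂ Linked (vertex-node a) (vertex-node b)
             (linked (node a) (node b) (subst W (sym (vertex-node a)) Wa) (subst W (sym (vertex-node b)) Wb))

    surviving-candidate : ∀ {n} → 3 < n → (cand : Fin n → List Node) →
                          (∀ {k i j} → k ∈ cand i → k ∈ cand j → i ≡ j) → ∃[ i ] All Alive (cand i)
    surviving-candidate 3<n cand disjoint =
      map₂ (All.map alive) (some-candidate-avoids _≟_ (map node deleted) fewer cand disjoint)
      where
        fewer : length (map node deleted) < _
        fewer = subst (_< _) (sym (length-map node deleted)) (ℕP.≤-<-trans few 3<n)

    module H = HyperLinking S W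

    linked-in-edge : ∀ {a b c} → IsEdge a b c → Alive a → Alive b → Alive c → ∀ {u v} →
                     u ∈₃ (vertex a , vertex b , vertex c) → v ∈₃ (vertex a , vertex b , vertex c) →
                     H.Linked u v
    linked-in-edge e Wa Wb Wc = H.linked-in-edge (edgeT e) inside
      where
        inside : ∀ v → v ∈₃ _ → W v
        inside _ (inj₁ refl)        = Wa
        inside _ (inj₂ (inj₁ refl)) = Wb
        inside _ (inj₂ (inj₂ refl)) = Wc

    leaves-linked-hub : ∀ c q p {p′} → p′ ≡ p ⊕ shift c →
                        Alive (hub c) → Alive (L q p) → Alive (R q p′) →
                        H.Linked (vertex (L q p)) (vertex (hub c)) × H.Linked (vertex (R q p′)) (vertex (hub c))
    leaves-linked-hub (top j) q p refl Wc WL WR =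
      linked-in-edge (topEdge q p j) WL WR Wc (inj₁ refl) (inj₂ (inj₂ refl)) ,
      linked-in-edge (topEdge q p j) WL WR Wc (inj₂ (inj₁ refl)) (inj₂ (inj₂ refl))
    leaves-linked-hub (bot j) q p refl Wc WL WR =
      linked-in-edge (botEdge q p j) Wc WL WR (inj₂ (inj₁ refl)) (inj₁ refl) ,
      linked-in-edge (botEdge q p j) Wc WL WR (inj₂ (inj₂ refl)) (inj₁ refl)

    top-edge-at-L : ∀ q p → ∃[ j ] (Alive (T j) × Alive (R q (p ⊕ shift (top j))))
    top-edge-at-L q p =
      map₂ (λ { (WT ∷ WR ∷ []) → WT , WR })
           (surviving-candidate ℕP.≤-refl (λ j → T j ∷ R q (p ⊕ shift (top j)) ∷ [])
              (labelled-disjoint label {tag = shift ∘ top} (FP.↑ˡ-injective 4 _ _)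
                 λ j → refl ∷ ⊕-⊖-cancelˡ p _ ∷ []))
      where
        label : Node → Fin 8
        label (T j)    = shift (top j)
        label (R _ p′) = p′ ⊖ p
        label _        = 0F

    top-edge-at-R : ∀ q p′ → ∃[ j ] (Alive (T j) × Alive (L q (p′ ⊖ shift (top j))))
    top-edge-at-R q p′ =
      map₂ (λ { (WT ∷ WL ∷ []) → WT , WL })
           (surviving-candidate ℕP.≤-refl (λ j → T j ∷ L q (p′ ⊖ shift (top j)) ∷ [])
              (labelled-disjoint label {tag = shift ∘ top} (FP.↑ˡ-injective 4 _ _)
                 λ j → refl ∷ ⊖-⊖-cancelˡ p′ _ ∷ []))
      where
        label : Node → Fin 8
        label (T j)   = shift (top j)
        label (L _ p) = p′ ⊖ p
        label _       = 0F

    block-between : ∀ c c′ →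
                    ∃[ q ] (Alive (L q 0F) × Alive (R q (0F ⊕ shift c)) × Alive (R q (0F ⊕ shift c′)))
    block-between c c′ =
      map₂ (λ { (WL ∷ WR ∷ WR′ ∷ []) → WL , WR , WR′ })
           (surviving-candidate (ℕP.m≤m+n 4 N)
              (λ q → L q 0F ∷ R q (0F ⊕ shift c) ∷ R q (0F ⊕ shift c′) ∷ [])
              (labelled-disjoint block id λ q → refl ∷ refl ∷ refl ∷ []))
      where
        block : Node → Fin Q
        block (L q _) = q
        block (R q _) = q
        block _       = 0F

    linked-to-hub : ∀ k → Alive k → ∃[ c ] (Alive (hub c) × H.Linked (vertex k) (vertex (hub c)))
    linked-to-hub (B j) WB = bot j , WB , H.linked-refl
    linked-to-hub (T j) WT = top j , WT , H.linked-refl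
    linked-to-hub (L q p) WL =
      let j , WT , WR = top-edge-at-L q p
      in top j , WT , proj₁ (leaves-linked-hub (top j) q p refl WT WL WR)
    linked-to-hub (R q p′) WR =
      let j , WT , WL = top-edge-at-R q p′
          s           = shift (top j)
      in top j , WT , proj₂ (leaves-linked-hub (top j) q (p′ ⊖ s) (sym (⊖-⊕-cancel p′ s)) WT WL WR)

    hubs-linked : ∀ c c′ → Alive (hub c) → Alive (hub c′) → H.Linked (vertex (hub c)) (vertex (hub c′))
    hubs-linked c c′ Wc Wc′ =
      let q , WL , WR , WR′ = block-between c c′
      in H.linked-trans (H.linked-sym (proj₁ (leaves-linked-hub c q 0F refl Wc WL WR)))
                        (proj₁ (leaves-linked-hub c′ q 0F refl Wc′ WL WR′))

    hypergraph-connected : ConnectedOn S W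
    hypergraph-connected = H.connectedOn (on-nodes linked)
      where
        linked : ∀ k k′ → Alive k → Alive k′ → H.Linked (vertex k) (vertex k′)
        linked k k′ Wk Wk′ =
          let c  , Wc  , k~c   = linked-to-hub k Wk
              c′ , Wc′ , k′~c′ = linked-to-hub k′ Wk′
          in H.linked-trans k~c (H.linked-trans (hubs-linked c c′ Wc Wc′) (H.linked-sym k′~c′))

    module G = GraphLinking {A = FAdj S} (FAdj-sym S) W

    some-top : ∃[ j ] Alive (T j)
    some-top = map₂ All.head
      (surviving-candidate ℕP.≤-refl (λ j → T j ∷ []) (labelled-disjoint label id λ j → refl ∷ []))
      where
        label : Node → Fin 4
        label (T j) = j
        label _     = 0F

    some-bot : ∃[ j ] Alive (B j)
    some-bot = map₂ All.head
      (surviving-candidate ℕP.≤-refl (λ j → B j ∷ []) (labelled-disjoint label id λ j → refl ∷ []))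
      where
        label : Node → Fin 4
        label (B j) = j
        label _     = 0F

    some-cross : ∃[ t ] (Alive (L 0F t) × Alive (R 2F t))
    some-cross = map₂ (λ { (WL ∷ WR ∷ []) → WL , WR })
      (surviving-candidate (ℕP.m≤m+n 4 4) (λ t → L 0F t ∷ R 2F t ∷ [])
         (labelled-disjoint position id λ t → refl ∷ refl ∷ []))
      where
        position : Node → Fin 8
        position (L _ p) = p
        position (R _ p) = p
        position _       = 0F

    adjacent-linked : ∀ k k′ → Alive k → Alive k′ → FAdj S (vertex k) (vertex k′) →
                      G.Linked (vertex k) (vertex k′) × G.Linked (vertex k′) (vertex k)
    adjacent-linked k k′ Wk Wk′ adj = k~k′ , G.linked-sym {vertex k} {vertex k′} k~k′
      where
        k~k′ : G.Linked (vertex k) (vertex k′)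
        k~k′ = G.linked-adjacent {vertex k} {vertex k′} Wk Wk′ adj

    module _ {t} (WL : Alive (L 0F t)) (WR : Alive (R 2F t)) where

      top-linked : ∀ j → Alive (T j) → G.Linked (vertex (T j)) (vertex (L 0F t))
      top-linked j WT = proj₂ (adjacent-linked (L 0F t) (T j) WL WT (adjacent-L-T 0F t j))

      bot-linked : ∀ j → Alive (B j) → G.Linked (vertex (B j)) (vertex (L 0F t))
      bot-linked j WB = G.linked-trans (proj₁ (adjacent-linked (B j) (R 2F t) WB WR (adjacent-B-R j 2F t)))
                                       (proj₂ (adjacent-linked (L 0F t) (R 2F t) WL WR (adjacent-L-R t)))

      linked-to-cross : ∀ k → Alive k → G.Linked (vertex k) (vertex (L 0F t))
      linked-to-cross (T j) WT = top-linked j WT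
      linked-to-cross (B j) WB = bot-linked j WB
      linked-to-cross (L q p) WL′ = let j , WT = some-top in
        G.linked-trans (proj₁ (adjacent-linked (L q p) (T j) WL′ WT (adjacent-L-T q p j))) (top-linked j WT)
      linked-to-cross (R q p) WR′ = let j , WB = some-bot in
        G.linked-trans (proj₂ (adjacent-linked (B j) (R q p) WB WR′ (adjacent-B-R j q p))) (bot-linked j WB)

    graph-connected : GraphConnectedOn (FAdj S) W
    graph-connected = G.graphConnectedOn (on-nodes linked)
      where
        linked : ∀ k k′ → Alive k → Alive k′ → G.Linked (vertex k) (vertex k′)
        linked k k′ Wk Wk′ =
          let t , WL , WR = some-cross
          in G.linked-trans (linked-to-cross WL WR k Wk) (G.linked-sym (linked-to-cross WL WR k′ Wk′))

proposition4p2 : (N : ℕ) → ∃[ S ] ((N ≤ n S) × Linear S × EVInseparable S × FourConnected (FAdj S))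
proposition4p2 N =
  S , N≤size , linear ,
  ((Deleting.hypergraph-connected [] ℕ.z≤n (λ _ _ → tt) , two-edges) ,
   (λ u v _ → Deleting.hypergraph-connected (u ∷ v ∷ []) (ℕ.s≤s (ℕ.s≤s ℕ.z≤n))
                λ _ w∉ → w∉ ∘ here , w∉ ∘ there ∘ here) ,
   (λ ((x , y , z) , _) → Deleting.hypergraph-connected (x ∷ y ∷ z ∷ []) ℕP.≤-refl
                λ _ w∉ → w∉ ∘ ∈₃⇒∈)) ,
  (4<size ,
   λ a b c → Deleting.graph-connected (a ∷ b ∷ c ∷ []) ℕP.≤-refl
                λ _ w∉ → w∉ ∘ here , w∉ ∘ there ∘ here , w∉ ∘ there ∘ there ∘ here)
  where open Construction N
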